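{- Let $n\ge1$ and let $H$ be the $n$-vertex path graph $P_n$ with a loop attached to one endpoint. For each $\lambda\vdash n$ let $G_\lambda$ be the disjoint union of $\ell(\lambda)$ path graphs with $\lambda_1,\dots,\lambda_{\ell(\lambda)}$ vertices respectively, each with a loop attached to one of its endpoints. Then $\{X_{G_\lambda}^H:\lambda\vdash n\}$ is a basis of $\Lambda^n$.
   Context: Graphs are finite and may have loops; a vertex with a loop counts as adjacent to itself. A graph homomorphism $f:G\to H$ is a map $V(G)\to V(H)$ such that whenever $u,v$ are adjacent in $G$ (possibly $u=v$ via a loop), $f(u),f(v)$ are adjacent in $H$. Its type is the partition of nonzero preimage sizes. For a partition $\lambda$ with $r_i(\lambda)$ parts equal to $i$ and $\ell(\lambda)\le N$, $m_\lambda^N=\frac{N!}{\binom{N}{r_1(\lambda),r_2(\lambda),\dots,N-\ell(\lambda)}}m_\lambda$ with $m_\lambda$ the monomial symmetric function. The $H$-chromatic symmetric function is $X_G^H=\sum_\lambda d_\lambda m_\lambda^{|V(H)|}$, $d_\lambda$ the number of homomorphisms $G\to H$ of type $\lambda$. $\Lambda^n$ is the $\mathbb{Q}$-vector space of homogeneous symmetric functions of degree $n$. -}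

module Defs where

open import Data.Bool using (Bool; true; false; _∧_; _∨_; if_then_else_)
open import Data.Nat as ℕ using (ℕ; zero; suc; _≤_; _≥_; _∸_; _!; _≡ᵇ_)
open import Data.Nat.Properties using (≤-decTotalOrder)
open import Data.Nat.ListAction using (sum; product)
open import Data.Fin as Fin using (Fin; toℕ; splitAt)
open import Data.Sum using (inj₁; inj₂)
open import Data.List using (List; []; _∷_; length; map; concatMap; allFin; reverse; filterᵇ; upTo; foldr)
import Data.List as List
open import Data.List.Relation.Unary.All using (All)
open import Data.List.Relation.Unary.Linked using (Linked)
open import Data.List.Membership.Propositional using (_∈_)
open import Data.List.Sort.InsertionSort.Base ≤-decTotalOrder using (sort)
open import Data.List.Properties using (≡-dec)
open import Data.Vec using (Vec; lookup)
import Data.Vec as Vec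
open import Data.Product using (Σ; ∃; _×_)
open import Data.Integer using (+_)
open import Data.Rational using (ℚ; 0ℚ; _+_; _*_; _/_)
open import Relation.Binary.PropositionalEquality using (_≡_)
open import Relation.Nullary.Decidable using (does)

-- Graphs (possibly with loops) on vertex set Fin k, given by a Boolean
-- adjacency relation; adj v v = true means v carries a loop.

Graph : ℕ → Set
Graph k = Fin k → Fin k → Bool

loopedPath : (m : ℕ) → Graph m
loopedPath m i j =
  (suc (toℕ i) ≡ᵇ toℕ j) ∨ (suc (toℕ j) ≡ᵇ toℕ i) ∨ ((toℕ i ≡ᵇ 0) ∧ (toℕ j ≡ᵇ 0))

_⊕_ : ∀ {a b} → Graph a → Graph b → Graph (a ℕ.+ b)
_⊕_ {a} G H u v with splitAt a u | splitAt a v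
... | inj₁ x | inj₁ y = G x y
... | inj₂ x | inj₂ y = H x y
... | _      | _      = false

emptyGraph : Graph 0
emptyGraph ()

Gλ : (λs : List ℕ) → Graph (sum λs)
Gλ []        = emptyGraph
Gλ (p ∷ ps)  = loopedPath p ⊕ Gλ ps

allMaps : (k N : ℕ) → List (Vec (Fin N) k)
allMaps zero    N = Vec.[] ∷ []
allMaps (suc k) N = concatMap (λ i → map (i Vec.∷_) (allMaps k N)) (allFin N)

allᵇ : ∀ {A : Set} → (A → Bool) → List A → Bool
allᵇ p = foldr (λ x b → p x ∧ b) true

isHom : ∀ {k N} → Graph k → Graph N → Vec (Fin N) k → Bool
isHom {k} G H f =
  allᵇ (λ u → allᵇ (λ v → if G u v then H (lookup f u) (lookup f v) else true)
                   (allFin k))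
       (allFin k)

countᵇ : ∀ {A : Set} → (A → Bool) → List A → ℕ
countᵇ p xs = length (filterᵇ p xs)

preimageSize : ∀ {k N} → Vec (Fin N) k → Fin N → ℕ
preimageSize {k} f j = countᵇ (λ u → toℕ (lookup f u) ≡ᵇ toℕ j) (allFin k)

type : ∀ {k N} → Vec (Fin N) k → List ℕ
type {N = N} f =
  reverse (sort (filterᵇ (λ s → 1 ℕ.≤ᵇ s) (map (preimageSize f) (allFin N))))

d : ∀ {k N} → Graph k → Graph N → List ℕ → ℕ
d {k} {N} G H μ =
  countᵇ (λ f → isHom G H f ∧ does (≡-dec ℕ._≟_ (type f) μ)) (allMaps k N)

r : ℕ → List ℕ → ℕ
r i μ = countᵇ (λ p → p ≡ᵇ i) μ

-- N! / multinomial(N; r₁, r₂, …, N − ℓ(μ))  =  (∏_{i≥1} r_i(μ)!) · (N − ℓ(μ))!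
-- (parts of μ are ≤ sum μ, so i ranges over 1 … sum μ).
mNfactor : ℕ → List ℕ → ℕ
mNfactor N μ =
  product (map (λ i → (r (suc i) μ) !) (upTo (sum μ)))
  ℕ.* ((N ∸ length μ) !)

-- Λ^n is modelled by coordinates in the monomial basis {m_μ : μ ⊢ n}:
-- an element is a function List ℕ → ℚ, only its values on partitions of n
-- being relevant.

IsPartition : ℕ → List ℕ → Set
IsPartition n μ = All (ℕ._≤_ 1) μ × Linked _≥_ μ × sum μ ≡ n

ℕtoℚ : ℕ → ℚ
ℕtoℚ m = (+ m) / 1

-- X_G^H = Σ_μ d_μ m_μ^N = Σ_μ d_μ · (N!/multinomial) · m_μ, in m-coordinates.
X : ∀ {k N} → Graph k → Graph N → List ℕ → ℚ
X {N = N} G H μ = ℕtoℚ (d G H μ ℕ.* mNfactor N μ)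

linComb : List (List ℕ) → (List ℕ → ℚ) → (List ℕ → List ℕ → ℚ) → List ℕ → ℚ
linComb ps c v μ = foldr (λ l acc → c l * v l μ + acc) 0ℚ ps

IsBasisΛ : ℕ → List (List ℕ) → (List ℕ → List ℕ → ℚ) → Set
IsBasisΛ n ps v =
  (∀ (c : List ℕ → ℚ) →
     (∀ μ → IsPartition n μ → linComb ps c v μ ≡ 0ℚ) →
     ∀ l → l ∈ ps → c l ≡ 0ℚ)
  ×
  (∀ (f : List ℕ → ℚ) →
     ∃ λ (c : List ℕ → ℚ) → ∀ μ → IsPartition n μ → linComb ps c v μ ≡ f μ)

module Submission where

-- Let λ′ be the conjugate of λ. Sending every vertex of G_λ to its distance from the loop
-- of its component is a homomorphism G_λ → H of type λ′, and every homomorphism f lies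
-- pointwise below it, since f maps a loop to the loop of H and adjacent vertices to
-- adjacent ones. So the cumulative fibre sizes of f dominate those of the distance map,
-- whose fibre sizes λ′ are nonincreasing; by Abel summation ∑ (parts of type f)² is then at
-- least ∑ λ′ᵢ², with equality only when type f = λ′. Hence, in the monomial basis,
-- X_{G_λ}^H has a nonzero coefficient at λ′ and is otherwise supported on partitions of
-- strictly larger square sum. As λ ↦ λ′ is an involution of the partitions of n, the
-- family is triangular with nonzero pivots, so it is a basis.

open import Defs
import Data.Nat.Properties as ℕP
open import Algebra.Properties.Semiring.Sum ℕP.+-*-semiring
  using (sum-syntax; sum-cong-≗; sum-replicate-zero; ∑-distrib-+; *-distribˡ-sum)
open import Data.Bool using (Bool; true; false; T; T?; if_then_else_; _∨_; _∧_)
open import Data.Bool.Properties using (T-∧; T-∨)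
open import Data.Empty using (⊥-elim)
open import Data.Fin as Fin using (Fin; toℕ; _↑ˡ_; _↑ʳ_; splitAt)
import Data.Fin.Properties as FP
import Data.Integer as ℤ
open import Data.Integer.GCD using (gcd)
import Data.Integer.Properties as ℤP
open import Data.List using (List; []; _∷_; tabulate; allFin; map; filterᵇ; upTo; length; applyUpTo; reverse)
open import Data.List.Extrema ℕP.≤-totalOrder using (max; xs≤max)
open import Data.List.Membership.Propositional using (_∈_)
open import Data.List.Membership.Propositional.Properties using (∈-map⁺; ∈-allFin; ∈-concat⁺′; ∈-filter⁺; ∈-filter⁻)
import Data.List.Properties as LP
open import Data.List.Relation.Binary.Permutation.Propositional using (_↭_; ↭-trans; ↭-sym; ↭⇒↭ₛ)
import Data.List.Relation.Binary.Permutation.Propositional.Properties as PermP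
open import Data.List.Relation.Binary.Pointwise using (Pointwise-≡⇒≡)
open import Data.List.Relation.Unary.All as All using (All; []; _∷_)
import Data.List.Relation.Unary.All.Properties as AllP
open import Data.List.Relation.Unary.AllPairs using (AllPairs; []; _∷_)
import Data.List.Relation.Unary.AllPairs.Properties as AllPairsP
open import Data.List.Relation.Unary.Any using (here; there)
import Data.List.Relation.Unary.Any.Properties as AnyP
open import Data.List.Relation.Unary.Linked as Linked using (Linked)
import Data.List.Relation.Unary.Linked.Properties as LinkP
open import Data.List.Relation.Unary.Sorted.TotalOrder.Properties using (↗↭↗⇒≋)
open import Data.List.Relation.Unary.Unique.Propositional using (Unique)
open import Data.List.Sort.InsertionSort.Base ℕP.≤-decTotalOrder using (sort)
open import Data.List.Sort.InsertionSort.Properties ℕP.≤-decTotalOrder using (sort-↭; sort-↗)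
open import Data.Nat as ℕ using (ℕ; zero; suc; _+_; _*_; _<_; _≤_; _≥_; z≤n; s≤s; ∣_-_∣; _≡ᵇ_; _<ᵇ_)
open import Data.Nat.ListAction using (sum)
open import Data.Nat.ListAction.Properties using (product≢0; sum-↭)
import Data.Nat.Solver as ℕS
open import Data.Product as Product using (∃; _×_; _,_; proj₁; proj₂)
open import Data.Rational as ℚ using (ℚ; 0ℚ; 1ℚ; _-_; 1/_)
import Data.Rational.Properties as ℚP
open import Data.Rational.Solver using (module +-*-Solver)
open import Data.Sum using (_⊎_; inj₁; inj₂; [_,_]′)
open import Data.Vec as Vec using (Vec; lookup; []; _∷_)
import Data.Vec.Properties as VP
open import Function using (_∘_; flip)
open import Function.Bundles using (Equivalence; _⇔_)
open import Relation.Binary.PropositionalEquality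
open import Relation.Nullary using (yes; no)
open import Relation.Nullary.Decidable using (Dec; does)

𝟙 : Bool → ℕ
𝟙 true  = 1
𝟙 false = 0

𝟙≤1 : ∀ b → 𝟙 b ≤ 1
𝟙≤1 true  = ℕP.≤-refl
𝟙≤1 false = z≤n

𝟙-<ᵇ-suc : ∀ t j → 𝟙 (t <ᵇ suc j) ≡ 𝟙 (t <ᵇ j) + 𝟙 (t ≡ᵇ j)
𝟙-<ᵇ-suc zero    zero    = refl
𝟙-<ᵇ-suc zero    (suc j) = refl
𝟙-<ᵇ-suc (suc t) zero    = refl
𝟙-<ᵇ-suc (suc t) (suc j) = 𝟙-<ᵇ-suc t j

𝟙-<ᵇ-antitone : ∀ {s t} j → s ≤ t → 𝟙 (t <ᵇ j) ≤ 𝟙 (s <ᵇ j)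
𝟙-<ᵇ-antitone                 zero    _         = z≤n
𝟙-<ᵇ-antitone {zero}  {zero}  (suc j) _         = ℕP.≤-refl
𝟙-<ᵇ-antitone {zero}  {suc t} (suc j) _         = 𝟙≤1 (t <ᵇ j)
𝟙-<ᵇ-antitone {suc s} {suc t} (suc j) (s≤s s≤t) = 𝟙-<ᵇ-antitone j s≤t

≤⇒<ᵇ≡false : ∀ {a b} → a ≤ b → (b <ᵇ a) ≡ false
≤⇒<ᵇ≡false z≤n       = refl
≤⇒<ᵇ≡false (s≤s a≤b) = ≤⇒<ᵇ≡false a≤b

<ᵇ≡false⇒≤ : ∀ a b → (a <ᵇ b) ≡ false → b ≤ a
<ᵇ≡false⇒≤ a b a≮b = ℕP.≮⇒≥ (λ a<b → subst T a≮b (ℕP.<⇒<ᵇ a<b))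

∑-++ : ∀ m n (f : Fin (m + n) → ℕ) →
       ∑[ i < m + n ] f i ≡ ∑[ i < m ] f (i ↑ˡ n) + ∑[ j < n ] f (m ↑ʳ j)
∑-++ zero    n f = refl
∑-++ (suc m) n f = trans (cong (f Fin.zero +_) (∑-++ m n (f ∘ Fin.suc))) (sym (ℕP.+-assoc (f Fin.zero) _ _))

∑-mono-≤ : ∀ {k} {f g : Fin k → ℕ} → (∀ i → f i ≤ g i) → ∑[ i < k ] f i ≤ ∑[ i < k ] g i
∑-mono-≤ {zero}  f≤g = z≤n
∑-mono-≤ {suc k} f≤g = ℕP.+-mono-≤ (f≤g Fin.zero) (∑-mono-≤ (f≤g ∘ Fin.suc))

countᵇ-tabulate : ∀ {A : Set} {k} (p : A → Bool) (g : Fin k → A) →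
                  countᵇ p (tabulate g) ≡ ∑[ i < k ] 𝟙 (p (g i))
countᵇ-tabulate {k = zero}  p g = refl
countᵇ-tabulate {k = suc k} p g with p (g Fin.zero)
... | true  = cong suc (countᵇ-tabulate p (g ∘ Fin.suc))
... | false = countᵇ-tabulate p (g ∘ Fin.suc)

countᵇ-allFin : ∀ {k} (p : Fin k → Bool) → countᵇ p (allFin k) ≡ ∑[ u < k ] 𝟙 (p u)
countᵇ-allFin p = countᵇ-tabulate p (λ u → u)

partialSum : (ℕ → ℕ) → ℕ → ℕ
partialSum h m = ∑[ i < m ] h (toℕ i)

partialSum-suc : ∀ h m → partialSum h (suc m) ≡ partialSum h m + h m
partialSum-suc h zero    = ℕP.+-identityʳ (h 0)
partialSum-suc h (suc m) = trans (cong (h 0 +_) (partialSum-suc (h ∘ suc) m)) (sym (ℕP.+-assoc (h 0) _ _))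

partialSum-+ : ∀ f g m → partialSum (λ i → f i + g i) m ≡ partialSum f m + partialSum g m
partialSum-+ f g m = ∑-distrib-+ {m} (f ∘ toℕ) (g ∘ toℕ)

partialSum-cong : ∀ {f g} m → (∀ i → f i ≡ g i) → partialSum f m ≡ partialSum g m
partialSum-cong m f≗g = sum-cong-≗ {m} (f≗g ∘ toℕ)

*-partialSum : ∀ x f m → x * partialSum f m ≡ partialSum (λ i → x * f i) m
*-partialSum x f m = *-distribˡ-sum {m} x (f ∘ toℕ)

sum-applyUpTo : ∀ h m → sum (applyUpTo h m) ≡ partialSum h m
sum-applyUpTo h zero    = refl
sum-applyUpTo h (suc m) = cong (h 0 +_) (sum-applyUpTo (h ∘ suc) m)

applyUpTo-cong : ∀ {f g : ℕ → ℕ} S → (∀ i → f i ≡ g i) → applyUpTo f S ≡ applyUpTo g S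
applyUpTo-cong zero    f≗g = refl
applyUpTo-cong (suc S) f≗g = cong₂ _∷_ (f≗g 0) (applyUpTo-cong S (f≗g ∘ suc))

tabulate-toℕ : ∀ (h : ℕ → ℕ) m → tabulate {n = m} (h ∘ toℕ) ≡ applyUpTo h m
tabulate-toℕ h zero    = refl
tabulate-toℕ h (suc m) = cong (h 0 ∷_) (tabulate-toℕ (h ∘ suc) m)

map-allFin-toℕ : ∀ (h : ℕ → ℕ) m → map (h ∘ toℕ) (allFin m) ≡ applyUpTo h m
map-allFin-toℕ h m = trans (LP.map-tabulate (λ i → i) (h ∘ toℕ)) (tabulate-toℕ h m)

-- Triangular families over ℚ

p*q≡0⇒p≡0 : ∀ {p q} → q ≢ 0ℚ → p ℚ.* q ≡ 0ℚ → p ≡ 0ℚ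
p*q≡0⇒p≡0 {p} {q} q≢0 pq≡0 = begin
  p                                 ≡⟨ sym (ℚP.*-identityʳ p) ⟩
  p ℚ.* 1ℚ                          ≡⟨ cong (p ℚ.*_) (sym (ℚP.*-inverseʳ q)) ⟩
  p ℚ.* (q ℚ.* 1/ q)                ≡⟨ sym (ℚP.*-assoc p q _) ⟩
  p ℚ.* q ℚ.* 1/ q                  ≡⟨ cong (ℚ._* 1/ q) pq≡0 ⟩
  0ℚ ℚ.* 1/ q                       ≡⟨ ℚP.*-zeroˡ (1/ q) ⟩
  0ℚ                                ∎
  where
  open ≡-Reasoning
  instance _ = ℚ.≢-nonZero q≢0

module _ (v : List ℕ → List ℕ → ℚ) where

  linComb-zero : ∀ xs c μ → (∀ {l} → l ∈ xs → c l ℚ.* v l μ ≡ 0ℚ) → linComb xs c v μ ≡ 0ℚ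
  linComb-zero []       c μ terms≡0 = refl
  linComb-zero (x ∷ xs) c μ terms≡0 =
    cong₂ ℚ._+_ (terms≡0 (here refl)) (linComb-zero xs c μ (terms≡0 ∘ there))

  linComb-single : ∀ {xs} → Unique xs → ∀ c μ {l} → l ∈ xs →
                   (∀ {k} → k ∈ xs → k ≢ l → c k ℚ.* v k μ ≡ 0ℚ) →
                   linComb xs c v μ ≡ c l ℚ.* v l μ
  linComb-single {x ∷ xs} (x∉xs ∷ _) c μ (here refl) others≡0 =
    trans (cong (c x ℚ.* v x μ ℚ.+_)
                (linComb-zero xs c μ (λ k∈ → others≡0 (there k∈) (λ { refl → All.lookup x∉xs k∈ refl }))))
          (ℚP.+-identityʳ _)
  linComb-single {x ∷ xs} (x∉xs ∷ xs-unique) c μ (there l∈) others≡0 =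
    trans (cong (ℚ._+ linComb xs c v μ) (others≡0 (here refl) (λ { refl → All.lookup x∉xs l∈ refl })))
          (trans (ℚP.+-identityˡ _) (linComb-single xs-unique c μ l∈ (others≡0 ∘ there)))

  linComb-+ : ∀ xs c d μ → linComb xs (λ l → c l ℚ.+ d l) v μ ≡ linComb xs c v μ ℚ.+ linComb xs d v μ
  linComb-+ []       c d μ = refl
  linComb-+ (x ∷ xs) c d μ = begin
      (c x ℚ.+ d x) ℚ.* v x μ ℚ.+ linComb xs (λ l → c l ℚ.+ d l) v μ
        ≡⟨ cong ((c x ℚ.+ d x) ℚ.* v x μ ℚ.+_) (linComb-+ xs c d μ) ⟩
      (c x ℚ.+ d x) ℚ.* v x μ ℚ.+ (linComb xs c v μ ℚ.+ linComb xs d v μ)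
        ≡⟨ solve 5 (λ a b y s t → (a :+ b) :* y :+ (s :+ t) := (a :* y :+ s) :+ (b :* y :+ t))
                 refl (c x) (d x) (v x μ) (linComb xs c v μ) (linComb xs d v μ) ⟩
      (c x ℚ.* v x μ ℚ.+ linComb xs c v μ) ℚ.+ (d x ℚ.* v x μ ℚ.+ linComb xs d v μ) ∎
    where
    open ≡-Reasoning
    open +-*-Solver

module Triangular
  (ps : List (List ℕ)) (ps-unique : Unique ps) (v : List ℕ → List ℕ → ℚ)
  (τ : List ℕ → List ℕ) (w : List ℕ → ℕ)
  (τ-∈ : ∀ {l} → l ∈ ps → τ l ∈ ps)
  (τ-involutive : ∀ {l} → l ∈ ps → τ (τ l) ≡ l)
  (v-diagonal : ∀ {l} → l ∈ ps → v l (τ l) ≢ 0ℚ)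
  (v-triangular : ∀ {l ν} → l ∈ ps → ν ∈ ps → v l ν ≢ 0ℚ → ν ≡ τ l ⊎ w (τ l) < w ν)
  where

  linComb-pivot : ∀ c {ν} → ν ∈ ps → (∀ {l} → l ∈ ps → w (τ l) < w ν → c l ≡ 0ℚ) →
                  linComb ps c v ν ≡ c (τ ν) ℚ.* v (τ ν) ν
  linComb-pivot c {ν} ν∈ c≡0 = linComb-single v ps-unique c ν (τ-∈ ν∈) term≡0
    where
    term≡0 : ∀ {l} → l ∈ ps → l ≢ τ ν → c l ℚ.* v l ν ≡ 0ℚ
    term≡0 {l} l∈ l≢τν with v l ν ℚP.≟ 0ℚ
    ... | yes v≡0 = trans (cong (c l ℚ.*_) v≡0) (ℚP.*-zeroʳ (c l))
    ... | no v≢0 with v-triangular l∈ ν∈ v≢0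
    ...   | inj₁ refl = ⊥-elim (l≢τν (sym (τ-involutive l∈)))
    ...   | inj₂ w< = trans (cong (ℚ._* v l ν) (c≡0 l∈ w<)) (ℚP.*-zeroˡ (v l ν))

  independent : ∀ c → (∀ {μ} → μ ∈ ps → linComb ps c v μ ≡ 0ℚ) → ∀ {l} → l ∈ ps → c l ≡ 0ℚ
  independent c lc≡0 {l} l∈ = vanish (suc (w (τ l))) l∈ ℕP.≤-refl
    where
    vanish : ∀ m {l} → l ∈ ps → w (τ l) < m → c l ≡ 0ℚ
    vanish (suc m) {l} l∈ (s≤s w≤m) = p*q≡0⇒p≡0 (v-diagonal l∈)
      (subst (λ k → c k ℚ.* v k (τ l) ≡ 0ℚ) (τ-involutive l∈)
        (trans (sym (linComb-pivot c (τ-∈ l∈) (λ k∈ w< → vanish m k∈ (ℕP.≤-trans w< w≤m))))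
               (lc≡0 (τ-∈ l∈))))

  Spanned : (List ℕ → ℚ) → Set
  Spanned f = ∃ λ c → ∀ {μ} → μ ∈ ps → linComb ps c v μ ≡ f μ

  VanishesBelow : ℕ → (List ℕ → ℚ) → Set
  VanishesBelow L f = ∀ {ν} → ν ∈ ps → w ν < L → f ν ≡ 0ℚ

  pivotCoefficients : ℕ → (List ℕ → ℚ) → List ℕ → ℚ
  pivotCoefficients L f l with w (τ l) ℕP.≟ L | v l (τ l) ℚP.≟ 0ℚ
  ... | yes _ | no v≢0 = f (τ l) ℚ.* (1/ v l (τ l)) {{ℚ.≢-nonZero v≢0}}
  ... | _     | _      = 0ℚ

  pivotCoefficients-off : ∀ L f {l} → w (τ l) ≢ L → pivotCoefficients L f l ≡ 0ℚ
  pivotCoefficients-off L f {l} w≢L with w (τ l) ℕP.≟ L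
  ... | yes w≡L = ⊥-elim (w≢L w≡L)
  ... | no _    = refl

  pivotCoefficients-on : ∀ L f {l} → l ∈ ps → w (τ l) ≡ L →
                         pivotCoefficients L f l ℚ.* v l (τ l) ≡ f (τ l)
  pivotCoefficients-on L f {l} l∈ w≡L with w (τ l) ℕP.≟ L | v l (τ l) ℚP.≟ 0ℚ
  ... | no w≢L | _      = ⊥-elim (w≢L w≡L)
  ... | yes _  | yes v≡0 = ⊥-elim (v-diagonal l∈ v≡0)
  ... | yes _  | no v≢0 = begin
      f (τ l) ℚ.* 1/ v l (τ l) ℚ.* v l (τ l)   ≡⟨ ℚP.*-assoc (f (τ l)) _ _ ⟩
      f (τ l) ℚ.* (1/ v l (τ l) ℚ.* v l (τ l)) ≡⟨ cong (f (τ l) ℚ.*_) (ℚP.*-inverseˡ (v l (τ l))) ⟩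
      f (τ l) ℚ.* 1ℚ                            ≡⟨ ℚP.*-identityʳ (f (τ l)) ⟩
      f (τ l)                                   ∎
    where
    open ≡-Reasoning
    instance _ = ℚ.≢-nonZero v≢0

  linComb-pivotCoefficients : ∀ L f {ν} → ν ∈ ps → w ν ≤ L →
    linComb ps (pivotCoefficients L f) v ν ≡ pivotCoefficients L f (τ ν) ℚ.* v (τ ν) ν
  linComb-pivotCoefficients L f ν∈ w≤L = linComb-pivot (pivotCoefficients L f) ν∈
    (λ _ w< → pivotCoefficients-off L f (λ w≡L → ℕP.<-irrefl w≡L (ℕP.<-≤-trans w< w≤L)))

  vanishesBelow-peel : ∀ L f → VanishesBelow L f →
    VanishesBelow (suc L) (λ μ → f μ - linComb ps (pivotCoefficients L f) v μ)
  vanishesBelow-peel L f f≡0 {ν} ν∈ (s≤s w≤L)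
    rewrite linComb-pivotCoefficients L f ν∈ w≤L with w ν ℕP.≟ L
  ... | yes w≡L = trans (cong (f ν -_) pivot≡f) (ℚP.+-inverseʳ (f ν))
    where
    pivot≡f : pivotCoefficients L f (τ ν) ℚ.* v (τ ν) ν ≡ f ν
    pivot≡f = subst (λ x → pivotCoefficients L f (τ ν) ℚ.* v (τ ν) x ≡ f x) (τ-involutive ν∈)
                (pivotCoefficients-on L f (τ-∈ ν∈) (trans (cong w (τ-involutive ν∈)) w≡L))
  ... | no w≢L
    rewrite f≡0 ν∈ (ℕP.≤∧≢⇒< w≤L w≢L)
          | pivotCoefficients-off L f {τ ν} (λ w≡L → w≢L (trans (cong w (sym (τ-involutive ν∈))) w≡L))
          | ℚP.*-zeroˡ (v (τ ν) ν) = refl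

  spanned-difference : ∀ c f → Spanned (λ μ → f μ - linComb ps c v μ) → Spanned f
  spanned-difference c f (d , d-spans) = (λ l → c l ℚ.+ d l) , λ {μ} μ∈ → begin
      linComb ps (λ l → c l ℚ.+ d l) v μ            ≡⟨ linComb-+ v ps c d μ ⟩
      linComb ps c v μ ℚ.+ linComb ps d v μ         ≡⟨ cong (linComb ps c v μ ℚ.+_) (d-spans μ∈) ⟩
      linComb ps c v μ ℚ.+ (f μ - linComb ps c v μ) ≡⟨ solve 2 (λ a b → a :+ (b :- a) := b) refl (linComb ps c v μ) (f μ) ⟩
      f μ                                           ∎
    where
    open ≡-Reasoning
    open +-*-Solver

  spanned-vanishingBelow : ∀ d L f → (∀ {ν} → ν ∈ ps → w ν < L + d) → VanishesBelow L f → Spanned f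
  spanned-vanishingBelow zero L f w<L f≡0 =
    (λ _ → 0ℚ) , λ {μ} μ∈ → trans (linComb-zero v ps (λ _ → 0ℚ) μ (λ {l} _ → ℚP.*-zeroˡ (v l μ)))
                                  (sym (f≡0 μ∈ (subst (w μ <_) (ℕP.+-identityʳ L) (w<L μ∈))))
  spanned-vanishingBelow (suc d) L f w<L+d f≡0 =
    spanned-difference (pivotCoefficients L f) f
      (spanned-vanishingBelow d (suc L) _ (λ {ν} ν∈ → subst (w ν <_) (ℕP.+-suc L d) (w<L+d ν∈))
        (vanishesBelow-peel L f f≡0))

  spanning : ∀ f → Spanned f
  spanning f = spanned-vanishingBelow (suc (max 0 (map w ps))) 0 f
    (λ ν∈ → s≤s (All.lookup (xs≤max 0 (map w ps)) (∈-map⁺ w ν∈))) (λ _ ())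

-- A majorization inequality

square : ℕ → ℕ
square x = x * x

square-+-square : ∀ a b → square b + square a ≡ square ∣ b - a ∣ + 2 * (a * b)
square-+-square a b with ℕP.≤-total a b
... | inj₁ a≤b with ℕP.m≤n⇒∃[o]m+o≡n a≤b
...   | k , refl rewrite ℕP.∣-∣-comm (a + k) a | ℕP.∣m-m+n∣≡n a k =
  solve 2 (λ a k → (a :+ k) :* (a :+ k) :+ a :* a := k :* k :+ con 2 :* (a :* (a :+ k))) refl a k
  where open ℕS.+-*-Solver
square-+-square a b | inj₂ b≤a with ℕP.m≤n⇒∃[o]m+o≡n b≤a
...   | k , refl rewrite ℕP.∣m-m+n∣≡n b k =
  solve 2 (λ b k → b :* b :+ (b :+ k) :* (b :+ k) := k :* k :+ con 2 :* ((b :+ k) :* b)) refl b k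
  where open ℕS.+-*-Solver

rearrangement₂ : ∀ x y A B → y ≤ x → A ≤ B → x * A + y * B ≤ x * B + y * A
rearrangement₂ x y A B y≤x A≤B with ℕP.m≤n⇒∃[o]m+o≡n y≤x | ℕP.m≤n⇒∃[o]m+o≡n A≤B
... | d , refl | e , refl = subst ((y + d) * A + y * (A + e) ≤_)
  (solve 4 (λ y d A e → ((y :+ d) :* A :+ y :* (A :+ e)) :+ d :* e := (y :+ d) :* (A :+ e) :+ y :* A) refl y d A e)
  (ℕP.m≤m+n _ (d * e))
  where open ℕS.+-*-Solver

partialSum≡0 : ∀ h m → partialSum h m ≡ 0 → ∀ {j} → j < m → h j ≡ 0
partialSum≡0 h (suc m) sum≡0 {j} j<1+m with ℕP.m+n≡0⇒m≡0 _ sum≡m | ℕP.m+n≡0⇒n≡0 (partialSum h m) sum≡m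
  where sum≡m = trans (sym (partialSum-suc h m)) sum≡0
... | init≡0 | last≡0 with j ℕP.≟ m
...   | yes refl = last≡0
...   | no j≢m   = partialSum≡0 h m init≡0 (ℕP.≤∧≢⇒< (ℕP.≤-pred j<1+m) j≢m)

module Majorization (a b : ℕ → ℕ) (a-antitone : ∀ j → a (suc j) ≤ a j)
                    (a≼b : ∀ j → partialSum a j ≤ partialSum b j) where

  ab : ℕ → ℕ
  ab i = a i * b i

  -- Abel summation: ∑_{i<m} aᵢ (bᵢ − aᵢ) ≥ aₘ (Bₘ − Aₘ) for the partial sums A, B, without subtraction.
  abel : ∀ m → partialSum (square ∘ a) m + a m * partialSum b m ≤ partialSum ab m + a m * partialSum a m
  abel zero    = ℕP.≤-refl
  abel (suc m) = ℕP.+-cancelʳ-≤ (x * B′) _ _ (begin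
      S′ + y * B′ + x * B′
        ≡⟨ solve 4 (λ s y x b → s :+ y :* b :+ x :* b := s :+ x :* b :+ y :* b) refl S′ y x B′ ⟩
      S′ + x * B′ + y * B′
        ≤⟨ ℕP.+-monoˡ-≤ (y * B′) step ⟩
      P′ + x * A′ + y * B′
        ≡⟨ ℕP.+-assoc P′ _ _ ⟩
      P′ + (x * A′ + y * B′)
        ≤⟨ ℕP.+-monoʳ-≤ P′ (rearrangement₂ x y A′ B′ (a-antitone m) (a≼b (suc m))) ⟩
      P′ + (x * B′ + y * A′)
        ≡⟨ solve 5 (λ p x y a b → p :+ (x :* b :+ y :* a) := p :+ y :* a :+ x :* b) refl P′ x y A′ B′ ⟩
      P′ + y * A′ + x * B′ ∎)
    where
    open ℕP.≤-Reasoning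
    open ℕS.+-*-Solver
    x = a m
    y = a (suc m)
    S = partialSum (square ∘ a) m
    P = partialSum ab m
    A = partialSum a m
    B = partialSum b m
    S′ = partialSum (square ∘ a) (suc m)
    P′ = partialSum ab (suc m)
    A′ = partialSum a (suc m)
    B′ = partialSum b (suc m)
    step : S′ + x * B′ ≤ P′ + x * A′
    step = begin
      S′ + x * B′
        ≡⟨ cong₂ (λ s t → s + x * t) (partialSum-suc (square ∘ a) m) (partialSum-suc b m) ⟩
      S + x * x + x * (B + b m)
        ≡⟨ solve 4 (λ s x β c → s :+ x :* x :+ x :* (β :+ c) := s :+ x :* β :+ (x :* x :+ x :* c))
                 refl S x B (b m) ⟩
      S + x * B + (x * x + x * b m)
        ≤⟨ ℕP.+-monoˡ-≤ (x * x + x * b m) (abel m) ⟩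
      P + x * A + (x * x + x * b m)
        ≡⟨ solve 4 (λ p x α c → p :+ x :* α :+ (x :* x :+ x :* c) := p :+ x :* c :+ x :* (α :+ x))
                 refl P x A (b m) ⟩
      P + x * b m + x * (A + x)
        ≡⟨ cong₂ (λ p t → p + x * t) (partialSum-suc ab m) (partialSum-suc a m) ⟨
      P′ + x * A′ ∎

  ∑a²≤∑ab : ∀ m → partialSum (square ∘ a) m ≤ partialSum ab m
  ∑a²≤∑ab m = ℕP.+-cancelʳ-≤ (a m * partialSum a m) _ _
    (ℕP.≤-trans (ℕP.+-monoʳ-≤ _ (ℕP.*-monoʳ-≤ (a m) (a≼b m))) (abel m))

  ∑a²+∑[b-a]²≤∑b² : ∀ m → partialSum (square ∘ a) m + partialSum (λ i → square ∣ b i - a i ∣) m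
                          ≤ partialSum (square ∘ b) m
  ∑a²+∑[b-a]²≤∑b² m = ℕP.+-cancelʳ-≤ Sa _ _ (begin
      Sa + D + Sa
        ≡⟨ solve 2 (λ s d → s :+ d :+ s := d :+ con 2 :* s) refl Sa D ⟩
      D + 2 * Sa
        ≤⟨ ℕP.+-monoʳ-≤ D (ℕP.*-monoʳ-≤ 2 (∑a²≤∑ab m)) ⟩
      D + 2 * partialSum ab m
        ≡⟨ cong (D +_) (*-partialSum 2 ab m) ⟩
      D + partialSum (λ i → 2 * ab i) m
        ≡⟨ partialSum-+ (λ i → square ∣ b i - a i ∣) (λ i → 2 * ab i) m ⟨
      partialSum (λ i → square ∣ b i - a i ∣ + 2 * ab i) m
        ≡⟨ partialSum-cong m (λ i → square-+-square (a i) (b i)) ⟨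
      partialSum (λ i → square (b i) + square (a i)) m
        ≡⟨ partialSum-+ (square ∘ b) (square ∘ a) m ⟩
      partialSum (square ∘ b) m + Sa ∎)
    where
    open ℕP.≤-Reasoning
    open ℕS.+-*-Solver
    Sa = partialSum (square ∘ a) m
    D = partialSum (λ i → square ∣ b i - a i ∣) m

  ∑a²≤∑b² : ∀ m → partialSum (square ∘ a) m ≤ partialSum (square ∘ b) m
  ∑a²≤∑b² m = ℕP.≤-trans (ℕP.m≤m+n _ _) (∑a²+∑[b-a]²≤∑b² m)

  ∑a²≡∑b²⇒a≡b : ∀ m → partialSum (square ∘ a) m ≡ partialSum (square ∘ b) m → ∀ {j} → j < m → a j ≡ b j
  ∑a²≡∑b²⇒a≡b m ∑≡ j<m with ℕP.m*n≡0⇒m≡0∨n≡0 _ (partialSum≡0 _ m ∑[b-a]²≡0 j<m)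
    where
    Sa = partialSum (square ∘ a) m
    ∑[b-a]²≡0 : partialSum (λ i → square ∣ b i - a i ∣) m ≡ 0
    ∑[b-a]²≡0 = ℕP.n≤0⇒n≡0 (ℕP.+-cancelˡ-≤ Sa _ 0 (begin
      Sa + partialSum (λ i → square ∣ b i - a i ∣) m ≤⟨ ∑a²+∑[b-a]²≤∑b² m ⟩
      partialSum (square ∘ b) m                      ≡⟨ ∑≡ ⟨
      Sa                                             ≡⟨ ℕP.+-identityʳ Sa ⟨
      Sa + 0                                         ∎))
      where open ℕP.≤-Reasoning
  ... | inj₁ ∣b-a∣≡0 = sym (ℕP.∣m-n∣≡0⇒m≡n ∣b-a∣≡0)
  ... | inj₂ ∣b-a∣≡0 = sym (ℕP.∣m-n∣≡0⇒m≡n ∣b-a∣≡0)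

IsHom : ∀ {k N} → Graph k → Graph N → (Fin k → Fin N) → Set
IsHom G H g = ∀ u v → T (G u v) → T (H (g u) (g v))

module _ {A : Set} (p : A → Bool) where

  allᵇ⇒All : ∀ xs → T (allᵇ p xs) → ∀ {x} → x ∈ xs → T (p x)
  allᵇ⇒All (y ∷ ys) all-p (here refl) = proj₁ (Equivalence.to T-∧ all-p)
  allᵇ⇒All (y ∷ ys) all-p (there x∈)  = allᵇ⇒All ys (proj₂ (Equivalence.to T-∧ all-p)) x∈

  All⇒allᵇ : ∀ xs → (∀ {x} → x ∈ xs → T (p x)) → T (allᵇ p xs)
  All⇒allᵇ []       _     = _
  All⇒allᵇ (y ∷ ys) p-all = Equivalence.from T-∧ (p-all (here refl) , All⇒allᵇ ys (p-all ∘ there))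

  countᵇ≢0⇒∃ : ∀ xs → countᵇ p xs ≢ 0 → ∃ λ x → x ∈ xs × T (p x)
  countᵇ≢0⇒∃ xs count≢0 with filterᵇ p xs in eq
  ... | []    = ⊥-elim (count≢0 refl)
  ... | x ∷ _ = x , ∈-filter⁻ (T? ∘ p) (subst (x ∈_) (sym eq) (here refl))

  ∈⇒countᵇ≢0 : ∀ {x xs} → x ∈ xs → T (p x) → countᵇ p xs ≢ 0
  ∈⇒countᵇ≢0 {x} {xs} x∈ px with filterᵇ p xs | ∈-filter⁺ (T? ∘ p) x∈ px
  ... | _ ∷ _ | _ = λ ()

isHom⇒IsHom : ∀ {k N} (G : Graph k) (H : Graph N) f → T (isHom G H f) → IsHom G H (lookup f)
isHom⇒IsHom {k} G H f hom u v with G u v | allᵇ⇒All _ (allFin k) (allᵇ⇒All _ (allFin k) hom (∈-allFin u)) (∈-allFin v)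
... | true | Huv = λ _ → Huv

IsHom⇒isHom : ∀ {k N} (G : Graph k) (H : Graph N) f → IsHom G H (lookup f) → T (isHom G H f)
IsHom⇒isHom {k} G H f hom = All⇒allᵇ _ (allFin k) (λ {u} _ → All⇒allᵇ _ (allFin k) (λ {v} _ → edge u v))
  where
  edge : ∀ u v → T (if G u v then H (lookup f u) (lookup f v) else true)
  edge u v with G u v | hom u v
  ... | true  | Huv = Huv _
  ... | false | _   = _

∈-allMaps : ∀ k N (f : Vec (Fin N) k) → f ∈ allMaps k N
∈-allMaps zero    N []      = here refl
∈-allMaps (suc k) N (i ∷ f) =
  ∈-concat⁺′ (∈-map⁺ (i ∷_) (∈-allMaps k N f)) (∈-map⁺ (λ j → map (j ∷_) (allMaps k N)) (∈-allFin i))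

T-does⇒ : ∀ {A : Set} (a? : Dec A) → T (does a?) → A
T-does⇒ (yes a) _ = a

T-does⇐ : ∀ {A : Set} (a? : Dec A) → A → T (does a?)
T-does⇐ (yes _)  _ = _
T-does⇐ (no ¬a)  a = ¬a a

d≢0⇒hom : ∀ {k N} (G : Graph k) (H : Graph N) μ → d G H μ ≢ 0 →
          ∃ λ f → T (isHom G H f) × type f ≡ μ
d≢0⇒hom {k} {N} G H μ d≢0 with countᵇ≢0⇒∃ _ (allMaps k N) d≢0
... | f , _ , hom∧type with Equivalence.to T-∧ hom∧type
...   | hom , type≡ = f , hom , T-does⇒ (LP.≡-dec ℕP._≟_ (type f) μ) type≡

hom⇒d≢0 : ∀ {k N} (G : Graph k) (H : Graph N) f → T (isHom G H f) → d G H (type f) ≢ 0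
hom⇒d≢0 {k} {N} G H f hom =
  ∈⇒countᵇ≢0 _ (∈-allMaps k N f) (Equivalence.from T-∧ (hom , T-does⇐ (LP.≡-dec ℕP._≟_ (type f) (type f)) refl))

ℕtoℚ≡0⇒≡0 : ∀ m → ℕtoℚ m ≡ 0ℚ → m ≡ 0
ℕtoℚ≡0⇒≡0 m m≡0 = ℤP.+-injective (begin
  ℤ.+ m                                           ≡⟨ sym (ℚP.↥-/ (ℤ.+ m) 1) ⟩
  ℚ.↥ ℕtoℚ m ℤ.* gcd (ℤ.+ m) (ℤ.+ 1)              ≡⟨ cong (λ q → ℚ.↥ q ℤ.* gcd (ℤ.+ m) (ℤ.+ 1)) m≡0 ⟩
  ℤ.+ 0                                           ∎)
  where open ≡-Reasoning

mNfactor≢0 : ∀ N μ → ℕ.NonZero (mNfactor N μ)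
mNfactor≢0 N μ = ℕP.m*n≢0 _ _
  {{product≢0 (AllP.map⁺ (All.universal (λ i → r (suc i) μ ℕP.!≢0) (upTo (sum μ))))}}
  {{(N ℕ.∸ length μ) ℕP.!≢0}}

X≢0⇒d≢0 : ∀ {k N} (G : Graph k) (H : Graph N) μ → X G H μ ≢ 0ℚ → d G H μ ≢ 0
X≢0⇒d≢0 {N = N} G H μ X≢0 d≡0 = X≢0 (cong (λ t → ℕtoℚ (t * mNfactor N μ)) d≡0)

d≢0⇒X≢0 : ∀ {k N} (G : Graph k) (H : Graph N) μ → d G H μ ≢ 0 → X G H μ ≢ 0ℚ
d≢0⇒X≢0 {N = N} G H μ d≢0 X≡0 =
  d≢0 (ℕP.m*n≡0⇒m≡0 _ _ {{mNfactor≢0 N μ}} (ℕtoℚ≡0⇒≡0 _ X≡0))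

↑ˡ-↑ʳ-elim : ∀ {m n} (P : Fin (m + n) → Set) → (∀ x → P (x ↑ˡ n)) → (∀ y → P (m ↑ʳ y)) → ∀ u → P u
↑ˡ-↑ʳ-elim {m} P left right u with splitAt m u in eq
... | inj₁ x = subst P (FP.splitAt⁻¹-↑ˡ eq) (left x)
... | inj₂ y = subst P (FP.splitAt⁻¹-↑ʳ eq) (right y)

module _ {a b} (G : Graph a) (G′ : Graph b) where

  ⊕-↑ˡ : ∀ x y → (G ⊕ G′) (x ↑ˡ b) (y ↑ˡ b) ≡ G x y
  ⊕-↑ˡ x y rewrite FP.splitAt-↑ˡ a x b | FP.splitAt-↑ˡ a y b = refl

  ⊕-↑ʳ : ∀ x y → (G ⊕ G′) (a ↑ʳ x) (a ↑ʳ y) ≡ G′ x y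
  ⊕-↑ʳ x y rewrite FP.splitAt-↑ʳ a b x | FP.splitAt-↑ʳ a b y = refl

  ⊕-↑ˡ-↑ʳ : ∀ x y → (G ⊕ G′) (x ↑ˡ b) (a ↑ʳ y) ≡ false
  ⊕-↑ˡ-↑ʳ x y rewrite FP.splitAt-↑ˡ a x b | FP.splitAt-↑ʳ a b y = refl

  ⊕-↑ʳ-↑ˡ : ∀ x y → (G ⊕ G′) (a ↑ʳ x) (y ↑ˡ b) ≡ false
  ⊕-↑ʳ-↑ˡ x y rewrite FP.splitAt-↑ʳ a b x | FP.splitAt-↑ˡ a y b = refl

  module _ {N} (H : Graph N) (g : Fin (a + b) → Fin N) where

    IsHom-⊕ˡ : IsHom (G ⊕ G′) H g → IsHom G H (g ∘ (_↑ˡ b))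
    IsHom-⊕ˡ hom x y = hom _ _ ∘ subst T (sym (⊕-↑ˡ x y))

    IsHom-⊕ʳ : IsHom (G ⊕ G′) H g → IsHom G′ H (g ∘ (a ↑ʳ_))
    IsHom-⊕ʳ hom x y = hom _ _ ∘ subst T (sym (⊕-↑ʳ x y))

    IsHom-⊕ : IsHom G H (g ∘ (_↑ˡ b)) → IsHom G′ H (g ∘ (a ↑ʳ_)) → IsHom (G ⊕ G′) H g
    IsHom-⊕ homˡ homʳ = ↑ˡ-↑ʳ-elim (λ u → ∀ v → T ((G ⊕ G′) u v) → T (H (g u) (g v)))
      (λ x → ↑ˡ-↑ʳ-elim _ (λ y → homˡ x y ∘ subst T (⊕-↑ˡ x y))
                          (λ y → ⊥-elim ∘ subst T (⊕-↑ˡ-↑ʳ x y)))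
      (λ x → ↑ˡ-↑ʳ-elim _ (λ y → ⊥-elim ∘ subst T (⊕-↑ʳ-↑ˡ x y))
                          (λ y → homʳ x y ∘ subst T (⊕-↑ʳ x y)))

-- loopedPath m i j reduces to pathAdjacent (toℕ i) (toℕ j).
pathAdjacent : ℕ → ℕ → Bool
pathAdjacent i j = (suc i ≡ᵇ j) ∨ (suc j ≡ᵇ i) ∨ ((i ≡ᵇ 0) ∧ (j ≡ᵇ 0))

pathAdjacent⇒≤suc : ∀ i j → T (pathAdjacent i j) → j ≤ suc i
pathAdjacent⇒≤suc i j adj with Equivalence.to T-∨ adj
... | inj₁ i+1≡j = ℕP.≤-reflexive (sym (ℕP.≡ᵇ⇒≡ (suc i) j i+1≡j))
... | inj₂ adj′ with Equivalence.to T-∨ adj′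
...   | inj₁ j+1≡i = ℕP.m<n⇒m≤1+n (ℕP.≤-reflexive (ℕP.≡ᵇ⇒≡ (suc j) i j+1≡i))
...   | inj₂ i≡0∧j≡0 with ℕP.≡ᵇ⇒≡ j 0 (proj₂ (Equivalence.to T-∧ i≡0∧j≡0))
...     | refl = z≤n

pathAdjacent-loop : ∀ i → T (pathAdjacent i i) → i ≡ 0
pathAdjacent-loop zero    _    = refl
pathAdjacent-loop (suc i) loop with Equivalence.to T-∨ loop
... | inj₁ i+2≡i+1 = ⊥-elim (ℕP.1+n≢n (ℕP.≡ᵇ⇒≡ (suc (suc i)) (suc i) i+2≡i+1))
... | inj₂ loop′ with Equivalence.to T-∨ loop′
...   | inj₁ i+2≡i+1 = ⊥-elim (ℕP.1+n≢n (ℕP.≡ᵇ⇒≡ (suc (suc i)) (suc i) i+2≡i+1))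

pathAdjacent-suc : ∀ i → T (pathAdjacent i (suc i))
pathAdjacent-suc i = Equivalence.from T-∨ (inj₁ (ℕP.≡⇒≡ᵇ (suc i) (suc i) refl))

IsHom-loopedPath-toℕ : ∀ {p n} (h : Fin p → Fin n) → (∀ x → toℕ (h x) ≡ toℕ x) →
                       IsHom (loopedPath p) (loopedPath n) h
IsHom-loopedPath-toℕ h h≡ x y = subst₂ (λ i j → T (pathAdjacent i j)) (sym (h≡ x)) (sym (h≡ y))

loopedPath-hom-≤ : ∀ {p n} (h : Fin p → Fin n) → IsHom (loopedPath p) (loopedPath n) h →
                   ∀ t x → toℕ x ≡ t → toℕ (h x) ≤ t
loopedPath-hom-≤ {suc p} h hom zero    Fin.zero refl = ℕP.≤-reflexive (pathAdjacent-loop _ (hom Fin.zero Fin.zero _))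
loopedPath-hom-≤ {suc p} h hom (suc t) (Fin.suc x) x≡t = ℕP.≤-trans
  (pathAdjacent⇒≤suc _ _ (hom (Fin.inject₁ x) (Fin.suc x) adjacent))
  (s≤s (loopedPath-hom-≤ h hom t (Fin.inject₁ x) (trans (FP.toℕ-inject₁ x) (ℕP.suc-injective x≡t))))
  where
  adjacent : T (loopedPath (suc p) (Fin.inject₁ x) (Fin.suc x))
  adjacent = subst (λ i → T (pathAdjacent i (suc (toℕ x)))) (sym (FP.toℕ-inject₁ x)) (pathAdjacent-suc (toℕ x))

-- The distance from u to the loop of its component of G_λ.
depth : (l : List ℕ) → Fin (sum l) → ℕ
depth (p ∷ ps) u = [ toℕ , depth ps ]′ (splitAt p u)

depth-↑ˡ : ∀ p ps x → depth (p ∷ ps) (x ↑ˡ sum ps) ≡ toℕ x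
depth-↑ˡ p ps x rewrite FP.splitAt-↑ˡ p x (sum ps) = refl

depth-↑ʳ : ∀ p ps y → depth (p ∷ ps) (p ↑ʳ y) ≡ depth ps y
depth-↑ʳ p ps y rewrite FP.splitAt-↑ʳ p (sum ps) y = refl

depth<sum : ∀ l u → depth l u < sum l
depth<sum (p ∷ ps) = ↑ˡ-↑ʳ-elim (λ u → depth (p ∷ ps) u < p + sum ps)
  (λ x → subst (_< p + sum ps) (sym (depth-↑ˡ p ps x)) (ℕP.<-≤-trans (FP.toℕ<n x) (ℕP.m≤m+n p (sum ps))))
  (λ y → subst (_< p + sum ps) (sym (depth-↑ʳ p ps y)) (ℕP.<-≤-trans (depth<sum ps y) (ℕP.m≤n+m (sum ps) p)))

IsHom-depth : ∀ n l (g : Fin (sum l) → Fin n) → (∀ u → toℕ (g u) ≡ depth l u) →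
              IsHom (Gλ l) (loopedPath n) g
IsHom-depth n []       g g≡depth ()
IsHom-depth n (p ∷ ps) g g≡depth = IsHom-⊕ (loopedPath p) (Gλ ps) (loopedPath n) g
  (IsHom-loopedPath-toℕ (g ∘ (_↑ˡ sum ps)) (λ x → trans (g≡depth _) (depth-↑ˡ p ps x)))
  (IsHom-depth n ps (g ∘ (p ↑ʳ_)) (λ y → trans (g≡depth _) (depth-↑ʳ p ps y)))

hom≤depth : ∀ n l (g : Fin (sum l) → Fin n) → IsHom (Gλ l) (loopedPath n) g → ∀ u → toℕ (g u) ≤ depth l u
hom≤depth n (p ∷ ps) g hom = ↑ˡ-↑ʳ-elim (λ u → toℕ (g u) ≤ depth (p ∷ ps) u)
  (λ x → subst (toℕ (g (x ↑ˡ sum ps)) ≤_) (sym (depth-↑ˡ p ps x))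
           (loopedPath-hom-≤ (g ∘ (_↑ˡ sum ps)) (IsHom-⊕ˡ (loopedPath p) (Gλ ps) (loopedPath n) g hom) (toℕ x) x refl))
  (λ y → subst (toℕ (g (p ↑ʳ y)) ≤_) (sym (depth-↑ʳ p ps y))
           (hom≤depth n ps (g ∘ (p ↑ʳ_)) (IsHom-⊕ʳ (loopedPath p) (Gλ ps) (loopedPath n) g hom) y))

-- partsAbove λ j = λ′_{j+1}, the number of parts of λ exceeding j.
partsAbove : List ℕ → ℕ → ℕ
partsAbove []       j = 0
partsAbove (p ∷ ps) j = 𝟙 (j <ᵇ p) + partsAbove ps j

partsAbove-antitone : ∀ l j → partsAbove l (suc j) ≤ partsAbove l j
partsAbove-antitone []       j = z≤n
partsAbove-antitone (p ∷ ps) j = ℕP.+-mono-≤ (𝟙-<ᵇ-antitone p (ℕP.n≤1+n j)) (partsAbove-antitone ps j)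

∑-toℕ≡ᵇ : ∀ p j → ∑[ x < p ] 𝟙 (toℕ x ≡ᵇ j) ≡ 𝟙 (j <ᵇ p)
∑-toℕ≡ᵇ zero    j       = refl
∑-toℕ≡ᵇ (suc p) zero    = cong suc (sum-replicate-zero p)
∑-toℕ≡ᵇ (suc p) (suc j) = ∑-toℕ≡ᵇ p j

∑-depth≡ᵇ : ∀ l j → ∑[ u < sum l ] 𝟙 (depth l u ≡ᵇ j) ≡ partsAbove l j
∑-depth≡ᵇ []       j = refl
∑-depth≡ᵇ (p ∷ ps) j = begin
    ∑[ u < p + sum ps ] 𝟙 (depth (p ∷ ps) u ≡ᵇ j)
      ≡⟨ ∑-++ p (sum ps) _ ⟩
    ∑[ x < p ] 𝟙 (depth (p ∷ ps) (x ↑ˡ sum ps) ≡ᵇ j) + ∑[ y < sum ps ] 𝟙 (depth (p ∷ ps) (p ↑ʳ y) ≡ᵇ j)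
      ≡⟨ cong₂ _+_ (sum-cong-≗ {p} (λ x → cong (λ t → 𝟙 (t ≡ᵇ j)) (depth-↑ˡ p ps x)))
                   (sum-cong-≗ {sum ps} (λ y → cong (λ t → 𝟙 (t ≡ᵇ j)) (depth-↑ʳ p ps y))) ⟩
    ∑[ x < p ] 𝟙 (toℕ x ≡ᵇ j) + ∑[ y < sum ps ] 𝟙 (depth ps y ≡ᵇ j)
      ≡⟨ cong₂ _+_ (∑-toℕ≡ᵇ p j) (∑-depth≡ᵇ ps j) ⟩
    partsAbove (p ∷ ps) j ∎
  where open ≡-Reasoning

-- Conjugate partitions

dropZeros : List ℕ → List ℕ
dropZeros = filterᵇ (1 ℕ.≤ᵇ_)

conj : List ℕ → List ℕ
conj l = dropZeros (applyUpTo (partsAbove l) (sum l))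

sum-dropZeros : ∀ xs → sum (dropZeros xs) ≡ sum xs
sum-dropZeros []           = refl
sum-dropZeros (zero  ∷ xs) = sum-dropZeros xs
sum-dropZeros (suc x ∷ xs) = cong (suc x +_) (sum-dropZeros xs)

dropZeros-positive : ∀ xs → All (1 ≤_) (dropZeros xs)
dropZeros-positive []           = []
dropZeros-positive (zero  ∷ xs) = dropZeros-positive xs
dropZeros-positive (suc x ∷ xs) = s≤s z≤n ∷ dropZeros-positive xs

dropZeros-linked : ∀ {xs} → Linked _≥_ xs → Linked _≥_ (dropZeros xs)
dropZeros-linked = LinkP.filter⁺ (T? ∘ (1 ℕ.≤ᵇ_)) (flip ℕP.≤-trans)

partsAbove-dropZeros : ∀ xs i → partsAbove (dropZeros xs) i ≡ partsAbove xs i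
partsAbove-dropZeros []           i = refl
partsAbove-dropZeros (zero  ∷ xs) i = partsAbove-dropZeros xs i
partsAbove-dropZeros (suc x ∷ xs) i = cong (𝟙 (i <ᵇ suc x) +_) (partsAbove-dropZeros xs i)

partialSum-𝟙< : ∀ p S → p ≤ S → partialSum (λ j → 𝟙 (j <ᵇ p)) S ≡ p
partialSum-𝟙< zero    S       _         = sum-replicate-zero S
partialSum-𝟙< (suc p) (suc S) (s≤s p≤S) = cong suc (partialSum-𝟙< p S p≤S)

partialSum-partsAbove : ∀ l S → All (_≤ S) l → partialSum (partsAbove l) S ≡ sum l
partialSum-partsAbove []       S []             = sum-replicate-zero S
partialSum-partsAbove (p ∷ ps) S (p≤S ∷ ps≤S) =
  trans (partialSum-+ (λ j → 𝟙 (j <ᵇ p)) (partsAbove ps) S)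
        (cong₂ _+_ (partialSum-𝟙< p S p≤S) (partialSum-partsAbove ps S ps≤S))

parts≤sum : ∀ l → All (_≤ sum l) l
parts≤sum []       = []
parts≤sum (p ∷ ps) = ℕP.m≤m+n p (sum ps) ∷ All.map (λ q≤ → ℕP.≤-trans q≤ (ℕP.m≤n+m (sum ps) p)) (parts≤sum ps)

sum-conj : ∀ l → sum (conj l) ≡ sum l
sum-conj l = begin
  sum (dropZeros (applyUpTo (partsAbove l) (sum l))) ≡⟨ sum-dropZeros (applyUpTo (partsAbove l) (sum l)) ⟩
  sum (applyUpTo (partsAbove l) (sum l))             ≡⟨ sum-applyUpTo (partsAbove l) (sum l) ⟩
  partialSum (partsAbove l) (sum l)                  ≡⟨ partialSum-partsAbove l (sum l) (parts≤sum l) ⟩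
  sum l                                              ∎
  where open ≡-Reasoning

conj-linked : ∀ l → Linked _≥_ (conj l)
conj-linked l = dropZeros-linked (LinkP.applyUpTo⁺₂ (partsAbove l) (sum l) (partsAbove-antitone l))

conj-isPartition : ∀ n l → IsPartition n l → IsPartition n (conj l)
conj-isPartition n l (_ , _ , sum≡n) =
  dropZeros-positive (applyUpTo (partsAbove l) (sum l)) , conj-linked l , trans (sum-conj l) sum≡n

-- part λ i = λ_{i+1}, and 0 beyond the length of λ.
part : List ℕ → ℕ → ℕ
part []       i       = 0
part (p ∷ ps) zero    = p
part (p ∷ ps) (suc i) = part ps i

part≤ : ∀ {p} l i → All (_≤ p) l → part l i ≤ p
part≤ []       i       []         = z≤n
part≤ (q ∷ qs) zero    (q≤p ∷ _)  = q≤p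
part≤ (q ∷ qs) (suc i) (_ ∷ qs≤p) = part≤ qs i qs≤p

partsAbove≡0 : ∀ {j} l → All (_≤ j) l → partsAbove l j ≡ 0
partsAbove≡0 []       []           = refl
partsAbove≡0 (p ∷ ps) (p≤j ∷ ps≤j) rewrite ≤⇒<ᵇ≡false p≤j = partsAbove≡0 ps ps≤j

linked-≤-head : ∀ {p ps} → Linked _≥_ (p ∷ ps) → All (_≤ p) ps
linked-≤-head Linked.[-]       = []
linked-≤-head (p≥q Linked.∷ lk) = LinkP.Linked⇒All (flip ℕP.≤-trans) p≥q lk

linked-tail-≤ : ∀ {p ps j} → Linked _≥_ (p ∷ ps) → p ≤ j → All (_≤ j) ps
linked-tail-≤ lk p≤j = All.map (λ q≤p → ℕP.≤-trans q≤p p≤j) (linked-≤-head lk)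

-- The Ferrers diagram of λ′ is the transpose of that of λ.
<ᵇ-partsAbove : ∀ l → Linked _≥_ l → ∀ i j → (i <ᵇ partsAbove l j) ≡ (j <ᵇ part l i)
<ᵇ-partsAbove []       lk i       j = refl
<ᵇ-partsAbove (p ∷ ps) lk zero    j with j <ᵇ p in j<p
... | true  = refl
... | false rewrite partsAbove≡0 ps (linked-tail-≤ lk (<ᵇ≡false⇒≤ j p j<p)) = refl
<ᵇ-partsAbove (p ∷ ps) lk (suc i) j with j <ᵇ p in j<p
... | true  = <ᵇ-partsAbove ps (Linked.tail lk) i j
... | false rewrite partsAbove≡0 ps (linked-tail-≤ lk (<ᵇ≡false⇒≤ j p j<p)) =
  sym (≤⇒<ᵇ≡false (ℕP.≤-trans (part≤ ps i (linked-≤-head lk)) (<ᵇ≡false⇒≤ j p j<p)))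

partsAbove-applyUpTo : ∀ {i q} S h → (∀ j → (i <ᵇ h j) ≡ (j <ᵇ q)) → q ≤ S → partsAbove (applyUpTo h S) i ≡ q
partsAbove-applyUpTo {q = zero}  zero    h h≡ _ = refl
partsAbove-applyUpTo {q = zero}  (suc S) h h≡ _ rewrite h≡ 0 = partsAbove-applyUpTo S (h ∘ suc) (h≡ ∘ suc) z≤n
partsAbove-applyUpTo {q = suc q} (suc S) h h≡ (s≤s q≤S) rewrite h≡ 0 =
  cong suc (partsAbove-applyUpTo S (h ∘ suc) (h≡ ∘ suc) q≤S)

partsAbove-conj : ∀ l → Linked _≥_ l → ∀ i → partsAbove (conj l) i ≡ part l i
partsAbove-conj l lk i = trans (partsAbove-dropZeros (applyUpTo (partsAbove l) (sum l)) i)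
  (partsAbove-applyUpTo (sum l) (partsAbove l) (<ᵇ-partsAbove l lk i) (part≤ l i (parts≤sum l)))

length≤sum : ∀ {l} → All (1 ≤_) l → length l ≤ sum l
length≤sum []           = z≤n
length≤sum (1≤p ∷ 1≤ps) = ℕP.+-mono-≤ 1≤p (length≤sum 1≤ps)

dropZeros-applyUpTo-part : ∀ l S → All (1 ≤_) l → length l ≤ S → dropZeros (applyUpTo (part l) S) ≡ l
dropZeros-applyUpTo-part []           zero    []            _         = refl
dropZeros-applyUpTo-part []           (suc S) []            _         = dropZeros-applyUpTo-part [] S [] z≤n
dropZeros-applyUpTo-part (suc p ∷ ps) (suc S) (_ ∷ 1≤ps) (s≤s len≤S) =
  cong (suc p ∷_) (dropZeros-applyUpTo-part ps S 1≤ps len≤S)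

conj-involutive : ∀ n l → IsPartition n l → conj (conj l) ≡ l
conj-involutive n l (1≤l , lk , _) = begin
  dropZeros (applyUpTo (partsAbove (conj l)) (sum (conj l)))
    ≡⟨ cong (dropZeros ∘ applyUpTo (partsAbove (conj l))) (sum-conj l) ⟩
  dropZeros (applyUpTo (partsAbove (conj l)) (sum l))
    ≡⟨ cong dropZeros (applyUpTo-cong (sum l) (partsAbove-conj l lk)) ⟩
  dropZeros (applyUpTo (part l) (sum l))
    ≡⟨ dropZeros-applyUpTo-part l (sum l) 1≤l (length≤sum 1≤l) ⟩
  l ∎
  where open ≡-Reasoning

All-reverse : ∀ {P : ℕ → Set} {xs} → All P xs → All P (reverse xs)
All-reverse pxs = All.tabulate (All.lookup pxs ∘ AnyP.reverse⁻)

AllPairs-reverse : ∀ {R : ℕ → ℕ → Set} {xs} → AllPairs R xs → AllPairs (flip R) (reverse xs)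
AllPairs-reverse {xs = []}     []           = []
AllPairs-reverse {xs = x ∷ xs} (Rx ∷ R-xs) rewrite LP.unfold-reverse x xs =
  AllPairsP.++⁺ (AllPairs-reverse R-xs) ([] ∷ []) (All.map (_∷ []) (All-reverse Rx))

reverse-sort : ∀ {xs} → Linked _≥_ xs → reverse (sort xs) ≡ xs
reverse-sort {xs} antitone = begin
  reverse (sort xs)         ≡⟨ cong reverse sort≡reverse ⟩
  reverse (reverse xs)      ≡⟨ LP.reverse-involutive xs ⟩
  xs                        ∎
  where
  open ≡-Reasoning
  reverse-sorted : Linked _≤_ (reverse xs)
  reverse-sorted = LinkP.AllPairs⇒Linked (AllPairs-reverse (LinkP.Linked⇒AllPairs (flip ℕP.≤-trans) antitone))
  sort≡reverse : sort xs ≡ reverse xs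
  sort≡reverse = Pointwise-≡⇒≡ (↗↭↗⇒≋ ℕP.≤-totalOrder (sort-↗ xs) reverse-sorted
                   (↭⇒↭ₛ (↭-trans (sort-↭ xs) (↭-sym (PermP.↭-reverse xs)))))

fibreSize : ∀ {k n} → Vec (Fin n) k → ℕ → ℕ
fibreSize {k} f j = countᵇ (λ u → toℕ (lookup f u) ≡ᵇ j) (allFin k)

fibreSize-∑ : ∀ {k n} (f : Vec (Fin n) k) j → fibreSize f j ≡ ∑[ u < k ] 𝟙 (toℕ (lookup f u) ≡ᵇ j)
fibreSize-∑ f j = countᵇ-allFin (λ u → toℕ (lookup f u) ≡ᵇ j)

partialSum-fibreSize : ∀ {k n} (f : Vec (Fin n) k) j →
                       partialSum (fibreSize f) j ≡ ∑[ u < k ] 𝟙 (toℕ (lookup f u) <ᵇ j)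
partialSum-fibreSize {k} f zero    = sym (sum-replicate-zero k)
partialSum-fibreSize {k} f (suc j) = begin
  partialSum (fibreSize f) (suc j)
    ≡⟨ partialSum-suc (fibreSize f) j ⟩
  partialSum (fibreSize f) j + fibreSize f j
    ≡⟨ cong₂ _+_ (partialSum-fibreSize f j) (fibreSize-∑ f j) ⟩
  ∑[ u < k ] 𝟙 (toℕ (lookup f u) <ᵇ j) + ∑[ u < k ] 𝟙 (toℕ (lookup f u) ≡ᵇ j)
    ≡⟨ ∑-distrib-+ {k} _ _ ⟨
  ∑[ u < k ] (𝟙 (toℕ (lookup f u) <ᵇ j) + 𝟙 (toℕ (lookup f u) ≡ᵇ j))
    ≡⟨ sum-cong-≗ {k} (λ u → 𝟙-<ᵇ-suc (toℕ (lookup f u)) j) ⟨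
  ∑[ u < k ] 𝟙 (toℕ (lookup f u) <ᵇ suc j) ∎
  where open ≡-Reasoning

partialSum-fibreSize-antitone : ∀ {k n} (f g : Vec (Fin n) k) → (∀ u → toℕ (lookup f u) ≤ toℕ (lookup g u)) →
                                ∀ j → partialSum (fibreSize g) j ≤ partialSum (fibreSize f) j
partialSum-fibreSize-antitone f g f≤g j =
  subst₂ _≤_ (sym (partialSum-fibreSize g j)) (sym (partialSum-fibreSize f j))
         (∑-mono-≤ (λ u → 𝟙-<ᵇ-antitone j (f≤g u)))

weight : List ℕ → ℕ
weight μ = sum (map square μ)

weight-↭ : ∀ {xs ys} → xs ↭ ys → weight xs ≡ weight ys
weight-↭ xs↭ys = sum-↭ (PermP.map⁺ square xs↭ys)

weight-dropZeros : ∀ xs → weight (dropZeros xs) ≡ weight xs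
weight-dropZeros []           = refl
weight-dropZeros (zero  ∷ xs) = weight-dropZeros xs
weight-dropZeros (suc x ∷ xs) = cong (square (suc x) +_) (weight-dropZeros xs)

weight-type : ∀ {k n} (f : Vec (Fin n) k) → weight (type f) ≡ partialSum (square ∘ fibreSize f) n
weight-type {n = n} f = begin
  weight (reverse (sort (dropZeros fibres)))    ≡⟨ weight-↭ (PermP.↭-reverse (sort (dropZeros fibres))) ⟩
  weight (sort (dropZeros fibres))              ≡⟨ weight-↭ (sort-↭ (dropZeros fibres)) ⟩
  weight (dropZeros fibres)                     ≡⟨ weight-dropZeros fibres ⟩
  weight fibres                                 ≡⟨ cong weight (map-allFin-toℕ (fibreSize f) n) ⟩
  sum (map square (applyUpTo (fibreSize f) n))  ≡⟨ cong sum (LP.map-applyUpTo (fibreSize f) square n) ⟩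
  sum (applyUpTo (square ∘ fibreSize f) n)      ≡⟨ sum-applyUpTo (square ∘ fibreSize f) n ⟩
  partialSum (square ∘ fibreSize f) n           ∎
  where
  open ≡-Reasoning
  fibres = map (preimageSize f) (allFin n)

type-cong : ∀ {n k k′} (f : Vec (Fin n) k) (g : Vec (Fin n) k′) →
            (∀ {j} → j < n → fibreSize f j ≡ fibreSize g j) → type f ≡ type g
type-cong {n} f g fibres≡ = cong (reverse ∘ sort ∘ dropZeros) (LP.map-cong (λ j → fibres≡ (FP.toℕ<n j)) (allFin n))

depthMap : ∀ n l → sum l ≡ n → Vec (Fin n) (sum l)
depthMap _ l refl = Vec.tabulate (λ u → Fin.fromℕ< (depth<sum l u))

toℕ-depthMap : ∀ n l (sum≡n : sum l ≡ n) u → toℕ (lookup (depthMap n l sum≡n) u) ≡ depth l u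
toℕ-depthMap _ l refl u rewrite VP.lookup∘tabulate (λ u → Fin.fromℕ< (depth<sum l u)) u = FP.toℕ-fromℕ< (depth<sum l u)

fibreSize-depthMap : ∀ n l (sum≡n : sum l ≡ n) j → fibreSize (depthMap n l sum≡n) j ≡ partsAbove l j
fibreSize-depthMap n l sum≡n j = begin
  fibreSize (depthMap n l sum≡n) j
    ≡⟨ fibreSize-∑ (depthMap n l sum≡n) j ⟩
  ∑[ u < sum l ] 𝟙 (toℕ (lookup (depthMap n l sum≡n) u) ≡ᵇ j)
    ≡⟨ sum-cong-≗ {sum l} (λ u → cong (λ t → 𝟙 (t ≡ᵇ j)) (toℕ-depthMap n l sum≡n u)) ⟩
  ∑[ u < sum l ] 𝟙 (depth l u ≡ᵇ j)
    ≡⟨ ∑-depth≡ᵇ l j ⟩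
  partsAbove l j ∎
  where open ≡-Reasoning

type-depthMap : ∀ n l (sum≡n : sum l ≡ n) → type (depthMap n l sum≡n) ≡ conj l
type-depthMap _ l refl = begin
  reverse (sort (dropZeros (map (preimageSize S) (allFin (sum l)))))
    ≡⟨ cong (reverse ∘ sort ∘ dropZeros) (trans (map-allFin-toℕ (fibreSize S) (sum l))
                                               (applyUpTo-cong (sum l) (fibreSize-depthMap (sum l) l refl))) ⟩
  reverse (sort (conj l))
    ≡⟨ reverse-sort (conj-linked l) ⟩
  conj l ∎
  where
  open ≡-Reasoning
  S = depthMap (sum l) l refl

-- Triangularity

hom⇒type≡conj⊎weight< : ∀ n l (sum≡n : sum l ≡ n) f → T (isHom (Gλ l) (loopedPath n) f) →
                        type f ≡ conj l ⊎ weight (conj l) < weight (type f)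
hom⇒type≡conj⊎weight< n l sum≡n f hom = [ inj₂ ∘ weight< , inj₁ ∘ type≡ ]′ (ℕP.m≤n⇒m<n∨m≡n (∑a²≤∑b² n))
  where
  S = depthMap n l sum≡n
  S-antitone : ∀ j → fibreSize S (suc j) ≤ fibreSize S j
  S-antitone j = subst₂ _≤_ (sym (fibreSize-depthMap n l sum≡n (suc j))) (sym (fibreSize-depthMap n l sum≡n j))
                       (partsAbove-antitone l j)
  f≤S : ∀ u → toℕ (lookup f u) ≤ toℕ (lookup S u)
  f≤S u = subst (toℕ (lookup f u) ≤_) (sym (toℕ-depthMap n l sum≡n u))
                (hom≤depth n l (lookup f) (isHom⇒IsHom (Gλ l) (loopedPath n) f hom) u)
  open Majorization (fibreSize S) (fibreSize f) S-antitone (partialSum-fibreSize-antitone f S f≤S)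
  weight-conj : weight (conj l) ≡ partialSum (square ∘ fibreSize S) n
  weight-conj = trans (cong weight (sym (type-depthMap n l sum≡n))) (weight-type S)
  weight< : partialSum (square ∘ fibreSize S) n < partialSum (square ∘ fibreSize f) n →
            weight (conj l) < weight (type f)
  weight< = subst₂ _<_ (sym weight-conj) (sym (weight-type f))
  type≡ : partialSum (square ∘ fibreSize S) n ≡ partialSum (square ∘ fibreSize f) n → type f ≡ conj l
  type≡ ∑≡ = trans (type-cong f S (λ j<n → sym (∑a²≡∑b²⇒a≡b n ∑≡ j<n))) (type-depthMap n l sum≡n)

X-diagonal : ∀ n l → sum l ≡ n → X (Gλ l) (loopedPath n) (conj l) ≢ 0ℚ
X-diagonal n l sum≡n = d≢0⇒X≢0 (Gλ l) (loopedPath n) (conj l)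
  (subst (λ μ → d (Gλ l) (loopedPath n) μ ≢ 0) (type-depthMap n l sum≡n)
    (hom⇒d≢0 (Gλ l) (loopedPath n) S (IsHom⇒isHom (Gλ l) (loopedPath n) S
      (IsHom-depth n l (lookup S) (toℕ-depthMap n l sum≡n)))))
  where S = depthMap n l sum≡n

X-triangular : ∀ n l → sum l ≡ n → ∀ ν → X (Gλ l) (loopedPath n) ν ≢ 0ℚ →
               ν ≡ conj l ⊎ weight (conj l) < weight ν
X-triangular n l sum≡n ν X≢0 with d≢0⇒hom (Gλ l) (loopedPath n) ν (X≢0⇒d≢0 (Gλ l) (loopedPath n) ν X≢0)
... | f , hom , refl = hom⇒type≡conj⊎weight< n l sum≡n f hom

proposition4p9 : (n : ℕ) → 1 ≤ n →
    (ps : List (List ℕ)) → Unique ps → (∀ μ → (μ ∈ ps) ⇔ IsPartition n μ) →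
    IsBasisΛ n ps (λ l → X (Gλ l) (loopedPath n))
proposition4p9 n _ ps ps-unique ps≡partitions =
    (λ c lc≡0 l l∈ → independent c (λ μ∈ → lc≡0 _ (partition μ∈)) l∈)
  , (λ f → Product.map₂ (λ spans μ μ⊢n → spans (Equivalence.from (ps≡partitions μ) μ⊢n)) (spanning f))
  where
  partition : ∀ {μ} → μ ∈ ps → IsPartition n μ
  partition {μ} = Equivalence.to (ps≡partitions μ)
  sum≡n : ∀ {l} → l ∈ ps → sum l ≡ n
  sum≡n = proj₂ ∘ proj₂ ∘ partition
  open Triangular ps ps-unique (λ l → X (Gλ l) (loopedPath n)) conj weight
    (λ {l} l∈ → Equivalence.from (ps≡partitions (conj l)) (conj-isPartition n l (partition l∈)))
    (λ {l} l∈ → conj-involutive n l (partition l∈))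
    (λ {l} l∈ → X-diagonal n l (sum≡n l∈))
    (λ {l} l∈ _ → X-triangular n l (sum≡n l∈) _)
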